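{- For all integers $2 \le k \le n$, $$N(OM,k,n)=\begin{cases}\left\lceil \frac{n-1}{k-1}\right\rceil & \text{if } n \text{ is even},\\[2pt] \left\lceil \frac{n-2}{k-1}\right\rceil & \text{if } n \text{ is odd}.\end{cases}$$
   Context: Majority problem: we are given $n$ balls indexed by $[n]=\{1,\dots,n\}$, each colored by one of two colors by an unknown coloring. A ball $i$ is a majority ball if more than $n/2$ balls (counting $i$) have the same color as $i$. The goal is to either identify a majority ball or correctly conclude that there is none (i.e. the two color classes have equal size). A query is a $k$-element subset $Q\subseteq[n]$. In the non-adaptive version, a family of queries is fixed in advance (all asked at once); the family is successful if for every coloring, the answers to all the queries determine a correct output (a ball that is a majority ball for every coloring consistent with the answers, or the conclusion that no majority ball exists for every coloring consistent with the answers). In the Output Model (OM), the answer to a query $Q$ is the unordered partition $\{Q',Q''\}$ of $Q$ into the set of balls of one color and the set of balls of the other color, with no indication of which color is which. $N(OM,k,n)$ denotes the minimum number of queries in a successful non-adaptive query family in this model (the number of queries needed in the worst case). -}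

module Defs where

open import Data.Nat using (ℕ; zero; suc; _+_; _*_; _∸_; _<_; _≤_)
open import Data.Nat.DivMod using (_/_; _%_)
open import Data.Bool using (Bool; true; false; not)
open import Data.Bool.Properties using () renaming (_≟_ to _≟ᵇ_)
open import Data.Fin using (Fin)
open import Data.Fin.Subset using (Subset; _∩_; ∣_∣)
open import Data.Vec using (tabulate)
open import Data.Product using (_×_; Σ; ∃)
open import Data.Sum using (_⊎_)
open import Relation.Nullary using (does)
open import Relation.Binary.PropositionalEquality using (_≡_)

Coloring : ℕ → Set
Coloring n = Fin n → Bool

colorClass : ∀ {n} → Coloring n → Bool → Subset n
colorClass c b = tabulate (λ j → does (c j ≟ᵇ b))

IsMajority : ∀ {n} → Coloring n → Fin n → Set
IsMajority {n} c i = n < 2 * ∣ colorClass c (c i) ∣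

NoMajority : ∀ {n} → Coloring n → Set
NoMajority {n} c = 2 * ∣ colorClass c true ∣ ≡ n

-- Output Model: the answer to query Q under c is the unordered partition
-- {Q ∩ class true , Q ∩ class false}.  Two colorings give the same
-- answer iff these unordered pairs of subsets coincide.
SameAnswer : ∀ {n} → Subset n → Coloring n → Coloring n → Set
SameAnswer Q c c' =
  ((Q ∩ colorClass c true ≡ Q ∩ colorClass c' true) ×
   (Q ∩ colorClass c false ≡ Q ∩ colorClass c' false))
  ⊎
  ((Q ∩ colorClass c true ≡ Q ∩ colorClass c' false) ×
   (Q ∩ colorClass c false ≡ Q ∩ colorClass c' true))

Family : ℕ → ℕ → Set
Family m n = Fin m → Subset n

AllSize : ∀ {m n} → ℕ → Family m n → Set
AllSize k F = ∀ q → ∣ F q ∣ ≡ k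

Consistent : ∀ {m n} → Family m n → Coloring n → Coloring n → Set
Consistent F c c' = ∀ q → SameAnswer (F q) c c'

Successful : ∀ {m n} → Family m n → Set
Successful {n = n} F = (c : Coloring n) →
  (Σ (Fin n) λ i → ∀ c' → Consistent F c c' → IsMajority c' i)
  ⊎ (∀ c' → Consistent F c c' → NoMajority c')

SolvableWith : ℕ → ℕ → ℕ → Set
SolvableWith k n m = Σ (Family m n) λ F → AllSize k F × Successful F

-- Ceiling division ⌈a / b⌉ (for b ≥ 1; the value at b = 0 is irrelevant).
ceilDiv : ℕ → ℕ → ℕ
ceilDiv a zero = 0
ceilDiv a (suc b) = (a + b) / suc b

NOMvalue : ℕ → ℕ → ℕ
NOMvalue k n with n % 2
... | zero  = ceilDiv (n ∸ 1) (k ∸ 1)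
... | suc _ = ceilDiv (n ∸ 2) (k ∸ 1)

-- The answer to a query Q only tells which balls of Q share a colour, so colourings that agree, up
-- to swapping the two colours, on each connected component of the hypergraph of queries are
-- indistinguishable.
--
-- Upper bound: windows of k consecutive balls, consecutive windows sharing a ball, connect the first
-- 2⌊n/2⌋ balls with ⌈(2⌊n/2⌋ − 1)/(k − 1)⌉ queries. This fixes the colouring of those balls up to a
-- swap: if one colour has more than ⌊n/2⌋ of them its balls are majority balls; if they split evenly,
-- the colouring is balanced (n even) or the remaining ball is a majority ball (n odd).
--
-- Lower bound: m queries of size k leave at least n − m(k − 1) components. For n even and two
-- components, choose a balanced colouring in which a union of components is not balanced; flipping
-- it gives an indistinguishable unbalanced colouring. For n odd and three components, colour each
-- with one or two more trues than falses; every ball is then outvoted in the colouring itself or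
-- after flipping its own component, so no ball is certified.

module Submission where

open import Defs
open import Data.Bool using (Bool; true; false; not; _∧_; _∨_; _xor_; if_then_else_)
open import Data.Bool.Properties
  using (not-involutive; ∧-identityʳ; ∧-zeroʳ; xor-assoc; xor-same; xor-identityʳ; T-≡)
  renaming (_≟_ to _≟ᵇ_)
open import Data.Empty using (⊥; ⊥-elim)
open import Data.Fin using (Fin; zero; suc; toℕ; fromℕ<)
open import Data.Fin.Properties using (toℕ-fromℕ<; toℕ-injective) renaming (_≟_ to _≟ᶠ_)
open import Data.Fin.Subset using (Subset; _∩_; ∣_∣; _∈_)
open import Data.Fin.Subset.Properties using (nonempty?)
open import Data.List using (List; []; _∷_; map; length; _++_)
open import Data.List.Properties using (length-map; length-++)
open import Data.List.Membership.Propositional using () renaming (_∈_ to _∈ₗ_)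
open import Data.List.Membership.Propositional.Properties using (∈-map⁺; ∈-++⁺ˡ; ∈-++⁺ʳ)
open import Data.List.Relation.Unary.Any using (here; there)
open import Data.Nat using (ℕ; zero; suc; _+_; _*_; _∸_; _≤_; _<_; _⊓_; _<ᵇ_; z≤n; s≤s; s≤s⁻¹; _≟_; _≤?_)
open import Data.Nat.Properties
open import Data.Nat.DivMod using (_/_; _%_; m<n*o⇒m/o<n; m/n*n≤m; m%n<n; m≡m%n+[m/n]*n)
open import Data.Nat.Tactic.RingSolver using (solve-∀)
open import Algebra.Properties.CommutativeSemigroup +-commutativeSemigroup using (interchange)
open import Data.Product using (Σ; ∃; _×_; _,_; proj₁; proj₂)
open import Data.Sum using (inj₁; inj₂)
open import Data.Vec using ([]; _∷_; tabulate; here; there)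
open import Data.Vec.Properties using (∷-injective; lookup⇒[]=; lookup∘tabulate)
open import Function using (_∘_; id; Equivalence)
open import Relation.Binary.Definitions using (tri<; tri≈; tri>)
open import Relation.Binary.PropositionalEquality
open import Relation.Nullary using (Dec; yes; no; does; ¬_; contradiction)
open import Relation.Nullary.Decidable using (dec-true; dec-false)

witness : ∀ {A : Set} (a? : Dec A) → does a? ≡ true → A
witness (yes a) _  = a
witness (no _)  ()

bit : Bool → ℕ
bit false = 0
bit true  = 1

count : ∀ {n} → (Fin n → Bool) → ℕ
count {zero}  f = 0
count {suc n} f = bit (f zero) + count (f ∘ suc)

singleton : ∀ {n} → Fin n → Fin n → Bool
singleton x i = does (i ≟ᶠ x)

∣tabulate∣≡count : ∀ {n} (f : Fin n → Bool) → ∣ tabulate f ∣ ≡ count f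
∣tabulate∣≡count {zero}  f = refl
∣tabulate∣≡count {suc n} f with f zero
... | true  = cong suc (∣tabulate∣≡count (f ∘ suc))
... | false = ∣tabulate∣≡count (f ∘ suc)

count-cong : ∀ {n} {f g : Fin n → Bool} → (∀ i → f i ≡ g i) → count f ≡ count g
count-cong {zero}  f≗g = refl
count-cong {suc n} f≗g = cong₂ _+_ (cong bit (f≗g zero)) (count-cong (f≗g ∘ suc))

count-+ : ∀ {n} {f g h : Fin n → Bool} →
          (∀ i → bit (f i) ≡ bit (g i) + bit (h i)) → count f ≡ count g + count h
count-+ {zero}          eq = refl
count-+ {suc n} {g = g} {h} eq =
  trans (cong₂ _+_ (eq zero) (count-+ (eq ∘ suc)))
        (interchange (bit (g zero)) (bit (h zero)) (count (g ∘ suc)) (count (h ∘ suc)))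

count-≤-+ : ∀ {n} {f g h : Fin n → Bool} →
            (∀ i → bit (f i) ≤ bit (g i) + bit (h i)) → count f ≤ count g + count h
count-≤-+ {zero}          le = z≤n
count-≤-+ {suc n} {g = g} {h} le =
  ≤-trans (+-mono-≤ (le zero) (count-≤-+ (le ∘ suc)))
          (≤-reflexive (interchange (bit (g zero)) (bit (h zero)) (count (g ∘ suc)) (count (h ∘ suc))))

count-+₃ : ∀ {n} {f g₀ g₁ g₂ : Fin n → Bool} →
           (∀ i → bit (f i) ≡ bit (g₀ i) + bit (g₁ i) + bit (g₂ i)) →
           count f ≡ count g₀ + count g₁ + count g₂
count-+₃ {zero}                 eq = refl
count-+₃ {suc n} {g₀ = g₀} {g₁} {g₂} eq =
  trans (cong₂ _+_ (eq zero) (count-+₃ (eq ∘ suc)))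
        (trans (interchange (b₀ + b₁) b₂ (count (g₀ ∘ suc) + count (g₁ ∘ suc)) (count (g₂ ∘ suc)))
               (cong (_+ (b₂ + count (g₂ ∘ suc))) (interchange b₀ b₁ (count (g₀ ∘ suc)) (count (g₁ ∘ suc)))))
  where
  b₀ = bit (g₀ zero)
  b₁ = bit (g₁ zero)
  b₂ = bit (g₂ zero)

count-false : ∀ n → count {n} (λ _ → false) ≡ 0
count-false zero    = refl
count-false (suc n) = count-false n

count-true : ∀ n → count {n} (λ _ → true) ≡ n
count-true zero    = refl
count-true (suc n) = cong suc (count-true n)

count-singleton : ∀ {n} (x : Fin n) → count (singleton x) ≡ 1
count-singleton {suc n} zero    = cong suc (count-false n)
count-singleton {suc n} (suc x) = count-singleton x

count-not : ∀ {n} (f : Fin n → Bool) → count f + count (not ∘ f) ≡ n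
count-not {n} f = trans (sym (count-+ (bit-not ∘ f))) (count-true n)
  where
  bit-not : ∀ b → 1 ≡ bit b + bit (not b)
  bit-not true  = refl
  bit-not false = refl

count-≤ : ∀ {n} (f : Fin n → Bool) → count f ≤ n
count-≤ f = ≤-trans (m≤m+n _ _) (≤-reflexive (count-not f))

count-split : ∀ {n} (g f : Fin n → Bool) →
              count f ≡ count (λ i → g i ∧ f i) + count (λ i → not (g i) ∧ f i)
count-split g f = count-+ (λ i → split (g i) (f i))
  where
  split : ∀ a b → bit b ≡ bit (a ∧ b) + bit (not a ∧ b)
  split true  b = sym (+-identityʳ _)
  split false b = refl

count-flip : ∀ {n} (k x : Fin n → Bool) →
             count (λ i → k i xor x i) + count (λ i → x i ∧ k i) ≡ count (λ i → not (x i) ∧ k i) + count x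
count-flip k x = trans (sym (count-+ (λ i → flipped (k i) (x i)))) (count-+ (λ i → original (k i) (x i)))
  where
  flipped : ∀ a b → bit (a ∨ b) ≡ bit (a xor b) + bit (b ∧ a)
  flipped false false = refl
  flipped false true  = refl
  flipped true  false = refl
  flipped true  true  = refl
  original : ∀ a b → bit (a ∨ b) ≡ bit (not b ∧ a) + bit b
  original false false = refl
  original false true  = refl
  original true  false = refl
  original true  true  = refl

count-pos : ∀ {n} {f : Fin n → Bool} i → f i ≡ true → 0 < count f
count-pos {f = f} zero    fi rewrite fi = s≤s z≤n
count-pos {f = f} (suc i) fi = ≤-trans (count-pos {f = f ∘ suc} i fi) (m≤n+m _ _)

count-witness : ∀ {n} (f : Fin n → Bool) → 0 < count f → ∃ λ i → f i ≡ true
count-witness {suc n} f pos with f zero in fz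
... | true  = zero , fz
... | false = let (i , fi) = count-witness (f ∘ suc) pos in suc i , fi

count-full : ∀ {n} (f : Fin n → Bool) → count f ≡ n → ∀ i → f i ≡ true
count-full {n} f full i with f i in fi
... | true  = refl
... | false = contradiction nothing-false (>⇒≢ (count-pos {f = not ∘ f} i (cong not fi)))
  where
  nothing-false : count (not ∘ f) ≡ 0
  nothing-false = +-cancelˡ-≡ (count f) _ 0 (trans (count-not f) (trans (sym full) (sym (+-identityʳ _))))

count-not-full : ∀ {n} (f : Fin n → Bool) → count f < n → ∃ λ i → f i ≡ false
count-not-full {n} f ∣f∣<n =
  let (i , ¬fi) = count-witness (not ∘ f) (+-cancelˡ-< (count f) 0 _ some-false) in i , not-true ¬fi
  where
  some-false : count f + 0 < count f + count (not ∘ f)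
  some-false = subst₂ _<_ (sym (+-identityʳ _)) (sym (count-not f)) ∣f∣<n
  not-true : ∀ {b} → not b ≡ true → b ≡ false
  not-true {false} _ = refl

below : ∀ {n} → ℕ → Fin n → Bool
below a i = toℕ i <ᵇ a

count-below : ∀ n a → count (below {n} a) ≡ a ⊓ n
count-below zero    a       = sym (⊓-zeroʳ a)
count-below (suc n) zero    = count-false (suc n)
count-below (suc n) (suc a) = cong suc (count-below n a)

<ᵇ-true : ∀ {a b} → a < b → (a <ᵇ b) ≡ true
<ᵇ-true = Equivalence.to T-≡ ∘ <⇒<ᵇ

<ᵇ-true⁻¹ : ∀ {a b} → (a <ᵇ b) ≡ true → a < b
<ᵇ-true⁻¹ {a} {b} = <ᵇ⇒< a b ∘ Equivalence.from T-≡

<ᵇ-false : ∀ {a b} → b ≤ a → (a <ᵇ b) ≡ false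
<ᵇ-false {a} {b} b≤a with a <ᵇ b in a<b
... | false = refl
... | true  = contradiction (<ᵇ-true⁻¹ a<b) (≤⇒≯ b≤a)

pick : ∀ {n} (p : Fin n → Bool) t → t ≤ count p →
       Σ (Fin n → Bool) λ g → (∀ i → g i ≡ true → p i ≡ true) × count g ≡ t
pick {zero}  p zero le = (λ ()) , (λ ()) , refl
pick {suc n} p t    le with p zero in p0
pick {suc n} p zero le | true = (λ _ → false) , (λ _ ()) , count-false (suc n)
pick {suc n} p (suc t) (s≤s le) | true =
  let (g , g⊆p , ∣g∣) = pick (p ∘ suc) t le in
  (λ { zero → true ; (suc i) → g i }) , (λ { zero _ → p0 ; (suc i) → g⊆p i }) , cong suc ∣g∣
... | false =
  let (g , g⊆p , ∣g∣) = pick (p ∘ suc) t le in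
  (λ { zero → false ; (suc i) → g i }) , (λ { zero () ; (suc i) → g⊆p i }) , ∣g∣

-- Answers

∩-tabulate⁻ : ∀ {n} (Q : Subset n) {f g : Fin n → Bool} →
              Q ∩ tabulate f ≡ Q ∩ tabulate g → ∀ {i} → i ∈ Q → f i ≡ g i
∩-tabulate⁻ (_ ∷ Q) eq here        = proj₁ (∷-injective eq)
∩-tabulate⁻ (_ ∷ Q) eq (there i∈Q) = ∩-tabulate⁻ Q (proj₂ (∷-injective eq)) i∈Q

∩-tabulate⁺ : ∀ {n} (Q : Subset n) {f g : Fin n → Bool} →
              (∀ {i} → i ∈ Q → f i ≡ g i) → Q ∩ tabulate f ≡ Q ∩ tabulate g
∩-tabulate⁺ []          f≗g = refl
∩-tabulate⁺ (true ∷ Q)  f≗g = cong₂ _∷_ (f≗g here) (∩-tabulate⁺ Q (λ i∈Q → f≗g (there i∈Q)))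
∩-tabulate⁺ (false ∷ Q) f≗g = cong (false ∷_) (∩-tabulate⁺ Q (λ i∈Q → f≗g (there i∈Q)))

does-≟-injective : ∀ {a b} u → does (a ≟ᵇ u) ≡ does (b ≟ᵇ u) → a ≡ b
does-≟-injective {false} {false} _ _ = refl
does-≟-injective {true}  {true}  _ _ = refl
does-≟-injective {false} {true}  false ()
does-≟-injective {false} {true}  true  ()
does-≟-injective {true}  {false} false ()
does-≟-injective {true}  {false} true  ()

does-≟-not : ∀ a u → does (a ≟ᵇ u) ≡ does (not a ≟ᵇ not u)
does-≟-not false false = refl
does-≟-not false true  = refl
does-≟-not true  false = refl
does-≟-not true  true  = refl

does-≟-xor : ∀ b a u → does ((b xor a) ≟ᵇ u) ≡ does (a ≟ᵇ (b xor u))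
does-≟-xor false a u = refl
does-≟-xor true  false false = refl
does-≟-xor true  false true  = refl
does-≟-xor true  true  false = refl
does-≟-xor true  true  true  = refl

sameAnswer⇒xor : ∀ {n} (Q : Subset n) {c c' : Coloring n} → SameAnswer Q c c' →
                 Σ Bool λ b → ∀ {i} → i ∈ Q → c' i ≡ b xor c i
sameAnswer⇒xor Q (inj₁ (same , _)) =
  false , λ i∈Q → sym (does-≟-injective true (∩-tabulate⁻ Q same i∈Q))
sameAnswer⇒xor Q {c} {c'} (inj₂ (swapped , _)) =
  true , λ {i} i∈Q → sym (trans (cong not (does-≟-injective true
    (trans (∩-tabulate⁻ Q swapped i∈Q) (does-≟-not (c' i) false)))) (not-involutive (c' i)))

xor⇒sameAnswer : ∀ {n} (Q : Subset n) {c c' : Coloring n} b →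
                 (∀ {i} → i ∈ Q → c' i ≡ b xor c i) → SameAnswer Q c c'
xor⇒sameAnswer Q false agree =
  inj₁ ( ∩-tabulate⁺ Q (λ i∈Q → cong (λ x → does (x ≟ᵇ true))  (sym (agree i∈Q)))
       , ∩-tabulate⁺ Q (λ i∈Q → cong (λ x → does (x ≟ᵇ false)) (sym (agree i∈Q))) )
xor⇒sameAnswer Q {c} {c'} true agree = inj₂ (∩-tabulate⁺ Q (swapped true) , ∩-tabulate⁺ Q (swapped false))
  where
  swapped : ∀ u {i} → i ∈ Q → does (c i ≟ᵇ u) ≡ does (c' i ≟ᵇ not u)
  swapped u {i} i∈Q = trans (does-≟-not (c i) u) (cong (λ x → does (x ≟ᵇ not u)) (sym (agree i∈Q)))

xor-involutiveˡ : ∀ a b → a xor (a xor b) ≡ b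
xor-involutiveˡ a b = trans (sym (xor-assoc a a b)) (cong (_xor b) (xor-same a))

xor-involutiveʳ : ∀ a b → (a xor b) xor b ≡ a
xor-involutiveʳ a b = trans (xor-assoc a b b) (trans (cong (a xor_) (xor-same b)) (xor-identityʳ a))

xor-cancelʳ : ∀ {b b'} a → b xor a ≡ b' xor a → b ≡ b'
xor-cancelʳ {b} {b'} a eq = trans (sym (xor-involutiveʳ b a)) (trans (cong (_xor a) eq) (xor-involutiveʳ b' a))

sameAnswer-propagates : ∀ {n} (Q : Subset n) {c c' : Coloring n} → SameAnswer Q c c' →
                        ∀ {i j b} → i ∈ Q → j ∈ Q → c' i ≡ b xor c i → c' j ≡ b xor c j
sameAnswer-propagates Q {c} {c'} same {i} {j} {b} i∈Q j∈Q c'i =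
  let (b' , agree) = sameAnswer⇒xor Q {c} {c'} same
  in trans (agree j∈Q) (cong (_xor c j) (xor-cancelʳ {b'} {b} (c i) (trans (sym (agree i∈Q)) c'i)))

ConstantOnQueries : ∀ {m n} {A : Set} → Family m n → (Fin n → A) → Set
ConstantOnQueries F f = ∀ q {i j} → i ∈ F q → j ∈ F q → f i ≡ f j

constantOnQueries-∘ : ∀ {m n} {A B : Set} {F : Family m n} {f : Fin n → A} (g : A → B) →
                      ConstantOnQueries F f → ConstantOnQueries F (g ∘ f)
constantOnQueries-∘ g constant q i∈ j∈ = cong g (constant q i∈ j∈)

module _ {m n : ℕ} (F : Family m n) where

  consistent-refl : (c : Coloring n) → Consistent F c c
  consistent-refl c q = inj₁ (refl , refl)

  flip-consistent : (key : Fin n → Bool) → ConstantOnQueries F key →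
                    (c : Coloring n) → Consistent F c (λ i → key i xor c i)
  flip-consistent key constant c q with nonempty? (F q)
  ... | yes (x , x∈Q) = xor⇒sameAnswer (F q) {c} {λ i → key i xor c i} (key x)
                          (λ i∈Q → cong (_xor c _) (constant q i∈Q x∈Q))
  ... | no  empty     = xor⇒sameAnswer (F q) {c} {λ i → key i xor c i} false
                          (λ {i} i∈Q → ⊥-elim (empty (i , i∈Q)))

∣colorClass∣ : ∀ {n} (c : Coloring n) u → ∣ colorClass c u ∣ ≡ count (λ i → does (c i ≟ᵇ u))
∣colorClass∣ c u = ∣tabulate∣≡count (λ i → does (c i ≟ᵇ u))

∣colorClass-true∣ : ∀ {n} (c : Coloring n) → ∣ colorClass c true ∣ ≡ count c
∣colorClass-true∣ c = trans (∣colorClass∣ c true) (count-cong (λ i → does-≟-true (c i)))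
  where
  does-≟-true : ∀ a → does (a ≟ᵇ true) ≡ a
  does-≟-true false = refl
  does-≟-true true  = refl

colorClass-sum : ∀ {n} (c : Coloring n) u → ∣ colorClass c u ∣ + ∣ colorClass c (not u) ∣ ≡ n
colorClass-sum {n} c u =
  trans (cong₂ _+_ (∣colorClass∣ c u) (∣colorClass∣ c (not u)))
        (trans (sym (count-+ {f = λ _ → true} (λ i → one-of (c i) u))) (count-true n))
  where
  one-of : ∀ a u → 1 ≡ bit (does (a ≟ᵇ u)) + bit (does (a ≟ᵇ not u))
  one-of false false = refl
  one-of false true  = refl
  one-of true  false = refl
  one-of true  true  = refl

double-colorClass-sum : ∀ {n} (c : Coloring n) u →
                        2 * ∣ colorClass c u ∣ + 2 * ∣ colorClass c (not u) ∣ ≡ n + n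
double-colorClass-sum {n} c u = begin
  2 * ∣ colorClass c u ∣ + 2 * ∣ colorClass c (not u) ∣ ≡⟨ sym (*-distribˡ-+ 2 ∣ colorClass c u ∣ _) ⟩
  2 * (∣ colorClass c u ∣ + ∣ colorClass c (not u) ∣)   ≡⟨ cong (2 *_) (colorClass-sum c u) ⟩
  2 * n                                                 ≡⟨ cong (n +_) (+-identityʳ n) ⟩
  n + n                                                 ∎
  where open ≡-Reasoning

noMajority-colorClass : ∀ {n} {c : Coloring n} → NoMajority c → ∀ u → 2 * ∣ colorClass c u ∣ ≡ n
noMajority-colorClass balanced true  = balanced
noMajority-colorClass {n} {c} balanced false =
  +-cancelˡ-≡ n _ _ (trans (cong (_+ 2 * ∣ colorClass c false ∣) (sym balanced))
                           (double-colorClass-sum c true))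

noMajority⇒¬IsMajority : ∀ {n} {c : Coloring n} → NoMajority c → ∀ i → ¬ IsMajority c i
noMajority⇒¬IsMajority {c = c} balanced i = <-irrefl (sym (noMajority-colorClass {c = c} balanced (c i)))

minority⇒¬IsMajority : ∀ {n} {c : Coloring n} {u i} →
                       n < 2 * ∣ colorClass c u ∣ → c i ≡ not u → ¬ IsMajority c i
minority⇒¬IsMajority {n} {c} {u} {i} u-wins ci majority =
  <-irrefl (sym (double-colorClass-sum c u))
    (+-mono-< u-wins (subst (λ v → n < 2 * ∣ colorClass c v ∣) ci majority))

-- Components of the query hypergraph

Labelling : ℕ → Set
Labelling n = Fin n → Fin n

roots : ∀ {n} → Labelling n → Fin n → Bool
roots ℓ i = does (ℓ i ≟ᶠ i)

root-fixed : ∀ {n} (ℓ : Labelling n) {i} → roots ℓ i ≡ true → ℓ i ≡ i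
root-fixed ℓ {i} = witness (ℓ i ≟ᶠ i)

count-roots-id : ∀ n → count (roots {n} id) ≡ n
count-roots-id n = trans (count-cong {n} (λ i → dec-true (i ≟ᶠ i) refl)) (count-true n)

merge : ∀ {n} → Labelling n → Fin n → Fin n → Labelling n
merge ℓ a b i = if does (ℓ i ≟ᶠ ℓ b) then ℓ a else ℓ i

merge-respects : ∀ {n} (ℓ : Labelling n) a b {u v} → ℓ u ≡ ℓ v → merge ℓ a b u ≡ merge ℓ a b v
merge-respects ℓ a b eq = cong (λ z → if does (z ≟ᶠ ℓ b) then ℓ a else z) eq

merge-joins : ∀ {n} (ℓ : Labelling n) a b → merge ℓ a b a ≡ merge ℓ a b b
merge-joins ℓ a b rewrite dec-true (ℓ b ≟ᶠ ℓ b) refl with does (ℓ a ≟ᶠ ℓ b)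
... | true  = refl
... | false = refl

count-roots-merge : ∀ {n} (ℓ : Labelling n) a b → count (roots ℓ) ≤ count (roots (merge ℓ a b)) + 1
count-roots-merge ℓ a b =
  ≤-trans (count-≤-+ pointwise) (≤-reflexive (cong (count (roots (merge ℓ a b)) +_) (count-singleton (ℓ b))))
  where
  pointwise : ∀ i → bit (roots ℓ i) ≤ bit (roots (merge ℓ a b) i) + bit (singleton (ℓ b) i)
  pointwise i with ℓ i ≟ᶠ i | i ≟ᶠ ℓ b
  ... | no  _    | _        = z≤n
  ... | yes _    | yes _    = m≤n+m 1 _
  ... | yes ℓi≡i | no  i≢ℓb
    rewrite dec-false (ℓ i ≟ᶠ ℓ b) (i≢ℓb ∘ trans (sym ℓi≡i)) | dec-true (ℓ i ≟ᶠ i) ℓi≡i = s≤s z≤n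

unite : ∀ {n} → Labelling n → List (Fin n × Fin n) → Labelling n
unite ℓ []             = ℓ
unite ℓ ((a , b) ∷ es) = unite (merge ℓ a b) es

unite-respects : ∀ {n} (ℓ : Labelling n) es {u v} → ℓ u ≡ ℓ v → unite ℓ es u ≡ unite ℓ es v
unite-respects ℓ []             eq = eq
unite-respects ℓ ((a , b) ∷ es) eq = unite-respects (merge ℓ a b) es (merge-respects ℓ a b eq)

unite-joins : ∀ {n} (ℓ : Labelling n) {es a b} → (a , b) ∈ₗ es → unite ℓ es a ≡ unite ℓ es b
unite-joins ℓ {(a , b) ∷ es} (here refl) = unite-respects (merge ℓ a b) es (merge-joins ℓ a b)
unite-joins ℓ {(a , b) ∷ es} (there e∈) = unite-joins (merge ℓ a b) e∈

count-roots-unite : ∀ {n} (ℓ : Labelling n) es → count (roots ℓ) ≤ count (roots (unite ℓ es)) + length es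
count-roots-unite ℓ []             = m≤m+n _ 0
count-roots-unite ℓ ((a , b) ∷ es) = begin
  count (roots ℓ)                     ≤⟨ count-roots-merge ℓ a b ⟩
  count (roots (merge ℓ a b)) + 1     ≤⟨ +-monoˡ-≤ 1 (count-roots-unite (merge ℓ a b) es) ⟩
  r + length es + 1                   ≡⟨ +-assoc r (length es) 1 ⟩
  r + (length es + 1)                 ≡⟨ cong (r +_) (+-comm (length es) 1) ⟩
  r + suc (length es)                 ∎
  where
  open ≤-Reasoning
  r = count (roots (unite (merge ℓ a b) es))

elements : ∀ {n} → Subset n → List (Fin n)
elements []          = []
elements (true ∷ Q)  = zero ∷ map suc (elements Q)
elements (false ∷ Q) = map suc (elements Q)

length-elements : ∀ {n} (Q : Subset n) → length (elements Q) ≡ ∣ Q ∣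
length-elements []          = refl
length-elements (true ∷ Q)  = cong suc (trans (length-map suc (elements Q)) (length-elements Q))
length-elements (false ∷ Q) = trans (length-map suc (elements Q)) (length-elements Q)

∈-elements : ∀ {n} {Q : Subset n} {i} → i ∈ Q → i ∈ₗ elements Q
∈-elements {Q = true ∷ Q}  here        = here refl
∈-elements {Q = true ∷ Q}  (there i∈Q) = there (∈-map⁺ suc (∈-elements i∈Q))
∈-elements {Q = false ∷ Q} (there i∈Q) = ∈-map⁺ suc (∈-elements i∈Q)

star : ∀ {n} → List (Fin n) → List (Fin n × Fin n)
star []       = []
star (x ∷ xs) = map (x ,_) xs

length-star : ∀ {n} (xs : List (Fin n)) → length (star xs) ≡ length xs ∸ 1
length-star []       = refl
length-star (x ∷ xs) = length-map (x ,_) xs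

star-connects : ∀ {n} (ℓ : Labelling n) {xs} → (∀ {a b} → (a , b) ∈ₗ star xs → ℓ a ≡ ℓ b) →
                ∀ {i j} → i ∈ₗ xs → j ∈ₗ xs → ℓ i ≡ ℓ j
star-connects ℓ {x ∷ xs} joined i∈ j∈ = trans (sym (from-centre i∈)) (from-centre j∈)
  where
  from-centre : ∀ {i} → i ∈ₗ x ∷ xs → ℓ x ≡ ℓ i
  from-centre (here refl) = refl
  from-centre (there i∈)  = joined (∈-map⁺ (x ,_) i∈)

edges : ∀ {m n} → Family m n → List (Fin n × Fin n)
edges {zero}  F = []
edges {suc m} F = star (elements (F zero)) ++ edges (F ∘ suc)

length-edges : ∀ {m n} k (F : Family m n) → AllSize k F → length (edges F) ≡ m * (k ∸ 1)
length-edges {zero}  k F size = refl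
length-edges {suc m} k F size = begin
  length (star (elements (F zero)) ++ edges (F ∘ suc))         ≡⟨ length-++ (star (elements (F zero))) ⟩
  length (star (elements (F zero))) + length (edges (F ∘ suc)) ≡⟨ cong₂ _+_ size₀ rest ⟩
  (k ∸ 1) + m * (k ∸ 1)                                        ∎
  where
  open ≡-Reasoning
  size₀ : length (star (elements (F zero))) ≡ k ∸ 1
  size₀ = trans (length-star (elements (F zero))) (cong (_∸ 1) (trans (length-elements (F zero)) (size zero)))
  rest : length (edges (F ∘ suc)) ≡ m * (k ∸ 1)
  rest = length-edges k (F ∘ suc) (size ∘ suc)

star⊆edges : ∀ {m n} (F : Family m n) q {e} → e ∈ₗ star (elements (F q)) → e ∈ₗ edges F
star⊆edges {suc m} F zero    e∈ = ∈-++⁺ˡ e∈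
star⊆edges {suc m} F (suc q) e∈ = ∈-++⁺ʳ (star (elements (F zero))) (star⊆edges (F ∘ suc) q e∈)

-- Each query of size k merges at most k − 1 classes, so at least n − m(k − 1) components remain.
components : ∀ {m n} k (F : Family m n) → AllSize k F →
             Σ (Labelling n) λ comp → ConstantOnQueries F comp × n ≤ count (roots comp) + m * (k ∸ 1)
components {m} {n} k F size = comp , constant , bound
  where
  comp : Labelling n
  comp = unite id (edges F)
  constant : ConstantOnQueries F comp
  constant q i∈ j∈ =
    star-connects comp (λ e∈ → unite-joins id (star⊆edges F q e∈)) (∈-elements i∈) (∈-elements j∈)
  bound : n ≤ count (roots comp) + m * (k ∸ 1)
  bound = subst₂ _≤_ (count-roots-id n) (cong (count (roots comp) +_) (length-edges k F size))
                 (count-roots-unite id (edges F))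

_∖_ : ∀ {n} → (Fin n → Bool) → Fin n → Fin n → Bool
(f ∖ x) i = f i ∧ not (singleton x i)

∖-member : ∀ {n} (f : Fin n → Bool) x {i} → (f ∖ x) i ≡ true → f i ≡ true × i ≢ x
∖-member f x {i} fi with f i | i ≟ᶠ x
... | true | no i≢x = refl , i≢x

remove-member : ∀ {n t} (f : Fin n → Bool) → suc t ≤ count f →
                Σ (Fin n) λ x → f x ≡ true × t ≤ count (f ∖ x)
remove-member f t<∣f∣ =
  let (x , fx) = count-witness f (≤-trans (s≤s z≤n) t<∣f∣)
      ∣f∣≤ = count-≤-+ {h = singleton x} (λ i → pointwise (f i) (singleton x i))
  in x , fx , s≤s⁻¹ (≤-trans t<∣f∣ (≤-trans ∣f∣≤ (≤-reflexive
                (trans (cong (count (f ∖ x) +_) (count-singleton x)) (+-comm _ 1)))))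
  where
  pointwise : ∀ a b → bit a ≤ bit (a ∧ not b) + bit b
  pointwise false b     = z≤n
  pointwise true  false = s≤s z≤n
  pointwise true  true  = s≤s z≤n

distinct-roots : ∀ {n} (ℓ : Labelling n) {x y} → roots ℓ x ≡ true → roots ℓ y ≡ true → x ≢ y → ℓ x ≢ ℓ y
distinct-roots ℓ rx ry x≢y ℓx≡ℓy = x≢y (trans (sym (root-fixed ℓ rx)) (trans ℓx≡ℓy (root-fixed ℓ ry)))

two-components : ∀ {n} (ℓ : Labelling n) → 2 ≤ count (roots ℓ) → Σ (Fin n) λ u → Σ (Fin n) λ v → ℓ u ≢ ℓ v
two-components ℓ 2≤ =
  let (x , rx , 1≤) = remove-member (roots ℓ) 2≤
      (y , ry′)     = count-witness (roots ℓ ∖ x) 1≤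
      (ry , y≢x)    = ∖-member (roots ℓ) x ry′
  in x , y , distinct-roots ℓ rx ry (y≢x ∘ sym)

three-components : ∀ {n} (ℓ : Labelling n) → 3 ≤ count (roots ℓ) →
                   Σ (Fin n) λ u → Σ (Fin n) λ v → Σ (Fin n) λ w → ℓ u ≢ ℓ v × ℓ u ≢ ℓ w × ℓ v ≢ ℓ w
three-components ℓ 3≤ =
  let (x , rx , 2≤)   = remove-member (roots ℓ) 3≤
      (y , ry′ , 1≤)  = remove-member (roots ℓ ∖ x) 2≤
      (z , rz″)       = count-witness ((roots ℓ ∖ x) ∖ y) 1≤
      (ry , y≢x)      = ∖-member (roots ℓ) x ry′
      (rz′ , z≢y)     = ∖-member (roots ℓ ∖ x) y rz″
      (rz , z≢x)      = ∖-member (roots ℓ) x rz′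
  in x , y , z , distinct-roots ℓ rx ry (y≢x ∘ sym) , distinct-roots ℓ rx rz (z≢x ∘ sym)
               , distinct-roots ℓ ry rz (z≢y ∘ sym)

-- Lower bound

halve : ∀ s → 0 < s → Σ ℕ λ a → Σ Bool λ e → s ≡ a + suc (a + bit e)
halve 1 _ = 0 , false , refl
halve 2 _ = 0 , true  , refl
halve (suc (suc (suc s))) _ with halve (suc s) (s≤s z≤n)
... | a , e , eq = suc a , e , trans (cong (2 +_) eq) (cong suc (sym (+-suc a (suc (a + bit e)))))

Σ₃ : (Fin 3 → ℕ) → ℕ
Σ₃ f = f zero + f (suc zero) + f (suc (suc zero))

≤-Σ₃ : ∀ f j → f j ≤ Σ₃ f
≤-Σ₃ f zero             = ≤-trans (m≤m+n (f zero) _) (m≤m+n _ _)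
≤-Σ₃ f (suc zero)       = ≤-trans (m≤n+m (f (suc zero)) (f zero)) (m≤m+n _ _)
≤-Σ₃ f (suc (suc zero)) = m≤n+m _ _

Σ₃-cong : ∀ {f g} → (∀ j → f j ≡ g j) → Σ₃ f ≡ Σ₃ g
Σ₃-cong f≗g = cong₂ _+_ (cong₂ _+_ (f≗g zero) (f≗g (suc zero))) (f≗g (suc (suc zero)))

three-part-surplus : ∀ a₀ a₁ a₂ b₀ b₁ b₂ →
  2 * (suc (a₀ + b₀) + suc (a₁ + b₁) + suc (a₂ + b₂))
    ≡ (a₀ + suc (a₀ + b₀)) + (a₁ + suc (a₁ + b₁)) + (a₂ + suc (a₂ + b₂)) + (3 + (b₀ + b₁ + b₂))
three-part-surplus = solve-∀

-- Of C trues among n balls, with surplus 2C − n = 3 + S, flipping a part whose surplus is 1 + e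
-- leaves x trues, still a majority unless S = 1 = e; but then n would be even.
outvoted : ∀ {h C S x} e → 2 * C ≡ suc (2 * h) + (3 + S) → bit e ≤ S → x + suc (bit e) ≡ C →
           suc (2 * h) < 2 * x
outvoted {h} {S = S} {x} false eq _ refl = +-cancelʳ-< 2 (suc (2 * h)) (2 * x) (begin-strict
  suc (2 * h) + 2       <⟨ +-monoʳ-< (suc (2 * h)) (s≤s (s≤s (s≤s z≤n))) ⟩
  suc (2 * h) + (3 + S) ≡⟨ sym eq ⟩
  2 * (x + 1)           ≡⟨ *-distribˡ-+ 2 x 1 ⟩
  2 * x + 2             ∎)
  where open ≤-Reasoning
outvoted {h} {S = suc zero} {x} true eq _ refl =
  contradiction (+-cancelʳ-≡ 4 (2 * x) (suc (2 * h)) (trans (sym (*-distribˡ-+ 2 x 2)) eq)) (even≢odd x h)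
outvoted {h} {S = suc (suc S)} {x} true eq _ refl = +-cancelʳ-< 4 (suc (2 * h)) (2 * x) (begin-strict
  suc (2 * h) + 4                 <⟨ +-monoʳ-< (suc (2 * h)) (s≤s (s≤s (s≤s (s≤s (s≤s z≤n))))) ⟩
  suc (2 * h) + (3 + suc (suc S)) ≡⟨ sym eq ⟩
  2 * (x + 2)                     ≡⟨ *-distribˡ-+ 2 x 2 ⟩
  2 * x + 4                       ∎)
  where open ≤-Reasoning

module _ {m n : ℕ} {F : Family m n} (success : Successful F) where

  balance-determined : ∀ {c c'} → NoMajority c → Consistent F c c' → NoMajority c'
  balance-determined {c} {c'} balanced consistent with success c
  ... | inj₁ (i , majority) =
    ⊥-elim (noMajority⇒¬IsMajority {c = c} balanced i (majority c (consistent-refl F c)))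
  ... | inj₂ no-majority    = no-majority c' consistent

  common-majority : ∀ {c} → ¬ NoMajority c → Σ (Fin n) λ i → ∀ c' → Consistent F c c' → IsMajority c' i
  common-majority {c} unbalanced with success c
  ... | inj₁ certified   = certified
  ... | inj₂ no-majority = ⊥-elim (unbalanced (no-majority c (consistent-refl F c)))

  -- Colour all of K and h − |K| balls outside it: balanced, but balanced no more once K is flipped.
  small-class-refutes : ∀ {h} → n ≡ 2 * h → (K : Fin n → Bool) →
                        ConstantOnQueries F K → 0 < count K → count K ≤ h → ⊥
  small-class-refutes {h} n≡2h K constant 0<p p≤h =
    <-irrefl (*-cancelˡ-≡ _ _ 2 flipped-balanced) (∸-monoʳ-< 0<p p≤h)
    where
    p = count K
    h≤∣¬K∣ : h ≤ count (not ∘ K)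
    h≤∣¬K∣ = +-cancelˡ-≤ p h _ (begin
      p + h               ≤⟨ +-monoˡ-≤ h p≤h ⟩
      h + h               ≡⟨ cong (h +_) (sym (+-identityʳ h)) ⟩
      2 * h               ≡⟨ sym n≡2h ⟩
      n                   ≡⟨ sym (count-not K) ⟩
      p + count (not ∘ K) ∎)
      where open ≤-Reasoning
    outside = pick (not ∘ K) (h ∸ p) (≤-trans (m∸n≤m h p) h≤∣¬K∣)
    g = proj₁ outside
    g⊆¬K : ∀ i → g i ≡ true → not (K i) ≡ true
    g⊆¬K = proj₁ (proj₂ outside)
    ∣g∣ : count g ≡ h ∸ p
    ∣g∣ = proj₂ (proj₂ outside)
    c : Coloring n
    c i = K i ∨ g i
    ∣c∣ : count c ≡ h
    ∣c∣ = trans (count-+ (λ i → disjoint (K i) (g i) (g⊆¬K i)))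
                (trans (cong (p +_) ∣g∣) (m+[n∸m]≡n p≤h))
      where
      disjoint : ∀ a b → (b ≡ true → not a ≡ true) → bit (a ∨ b) ≡ bit a + bit b
      disjoint false b     _ = refl
      disjoint true  false _ = refl
      disjoint true  true  t = contradiction (t refl) λ ()
    flip-leaves-g : ∀ i → K i xor c i ≡ g i
    flip-leaves-g i = leaves (K i) (g i) (g⊆¬K i)
      where
      leaves : ∀ a b → (b ≡ true → not a ≡ true) → a xor (a ∨ b) ≡ b
      leaves false b     _ = refl
      leaves true  false _ = refl
      leaves true  true  t = contradiction (t refl) λ ()
    balanced : NoMajority c
    balanced = trans (cong (2 *_) (trans (∣colorClass-true∣ c) ∣c∣)) (sym n≡2h)
    flipped : Coloring n
    flipped i = K i xor c i
    flipped-balanced : 2 * (h ∸ p) ≡ 2 * h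
    flipped-balanced = begin
      2 * (h ∸ p)                     ≡⟨ cong (2 *_) (sym (trans (count-cong flip-leaves-g) ∣g∣)) ⟩
      2 * count flipped               ≡⟨ cong (2 *_) (sym (∣colorClass-true∣ flipped)) ⟩
      2 * ∣ colorClass flipped true ∣ ≡⟨ balance-determined {c = c} {flipped} balanced
                                          (flip-consistent F K constant c) ⟩
      n                               ≡⟨ n≡2h ⟩
      2 * h                           ∎
      where open ≡-Reasoning

  module _ (comp : Labelling n) (constant : ConstantOnQueries F comp) where

    component : Fin n → Fin n → Bool
    component u i = does (comp i ≟ᶠ comp u)

    component-constant : ∀ u → ConstantOnQueries F (component u)
    component-constant u = constantOnQueries-∘ (λ z → does (z ≟ᶠ comp u)) constant

    -- Either the component of u or its complement has at most h balls.
    two-components-refute : ∀ {h u v} → n ≡ 2 * h → comp u ≢ comp v → ⊥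
    two-components-refute {h} {u} {v} n≡2h cu≢cv with count (component u) ≤? h
    ... | yes small = small-class-refutes n≡2h (component u) (component-constant u) u-inside small
      where
      u-inside : 0 < count (component u)
      u-inside = count-pos u (dec-true (comp u ≟ᶠ comp u) refl)
    ... | no  large = small-class-refutes n≡2h (not ∘ component u)
                        (constantOnQueries-∘ not (component-constant u)) v-outside small
      where
      v-outside : 0 < count (not ∘ component u)
      v-outside = count-pos v (cong not (dec-false (comp v ≟ᶠ comp u) (cu≢cv ∘ sym)))
      small : count (not ∘ component u) ≤ h
      small = <⇒≤ (+-cancelˡ-< h _ h (<-≤-trans (+-monoˡ-< _ (≰⇒> large))
                 (≤-reflexive (trans (count-not (component u)) (trans n≡2h (cong (h +_) (+-identityʳ h)))))))

    module ThreeParts {h u₀ u₁ u₂} (n≡odd : n ≡ suc (2 * h))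
                      (d₀₁ : comp u₀ ≢ comp u₁) (d₀₂ : comp u₀ ≢ comp u₂) (d₁₂ : comp u₁ ≢ comp u₂) where

      partOf : Fin n → Fin 3
      partOf z = if does (z ≟ᶠ comp u₀) then zero
                 else if does (z ≟ᶠ comp u₁) then suc zero
                 else suc (suc zero)

      part : Fin n → Fin 3
      part = partOf ∘ comp

      inPart : Fin 3 → Fin n → Bool
      inPart j i = does (part i ≟ᶠ j)

      inPart-constant : ∀ j → ConstantOnQueries F (inPart j)
      inPart-constant j = constantOnQueries-∘ (λ z → does (partOf z ≟ᶠ j)) constant

      pivot : Fin 3 → Fin n
      pivot zero             = u₀
      pivot (suc zero)       = u₁
      pivot (suc (suc zero)) = u₂

      part-pivot : ∀ j → part (pivot j) ≡ j
      part-pivot zero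
        rewrite dec-true (comp u₀ ≟ᶠ comp u₀) refl = refl
      part-pivot (suc zero)
        rewrite dec-false (comp u₁ ≟ᶠ comp u₀) (d₀₁ ∘ sym) | dec-true (comp u₁ ≟ᶠ comp u₁) refl = refl
      part-pivot (suc (suc zero))
        rewrite dec-false (comp u₂ ≟ᶠ comp u₀) (d₀₂ ∘ sym) | dec-false (comp u₂ ≟ᶠ comp u₁) (d₁₂ ∘ sym) = refl

      count-by-part : ∀ x → count x ≡ Σ₃ λ j → count (λ i → x i ∧ inPart j i)
      count-by-part x = count-+₃ (λ i → split (part i) (x i))
        where
        split : ∀ p b → bit b ≡ bit (b ∧ does (p ≟ᶠ zero)) + bit (b ∧ does (p ≟ᶠ suc zero))
                                + bit (b ∧ does (p ≟ᶠ suc (suc zero)))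
        split zero             false = refl
        split zero             true  = refl
        split (suc zero)       false = refl
        split (suc zero)       true  = refl
        split (suc (suc zero)) false = refl
        split (suc (suc zero)) true  = refl

      decomposition : ∀ j → Σ ℕ λ a → Σ Bool λ e → count (inPart j) ≡ a + suc (a + bit e)
      decomposition j = halve _ (count-pos (pivot j) (dec-true (part (pivot j) ≟ᶠ j) (part-pivot j)))

      a : Fin 3 → ℕ
      a j = proj₁ (decomposition j)

      e : Fin 3 → Bool
      e j = proj₁ (proj₂ (decomposition j))

      t : Fin 3 → ℕ
      t j = suc (a j + bit (e j))

      ∣part∣ : ∀ j → count (inPart j) ≡ a j + t j
      ∣part∣ j = proj₂ (proj₂ (decomposition j))

      chosen : ∀ j → Σ (Fin n → Bool) λ g → (∀ i → g i ≡ true → inPart j i ≡ true) × count g ≡ t j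
      chosen j = pick (inPart j) (t j) (subst (t j ≤_) (sym (∣part∣ j)) (m≤n+m (t j) (a j)))

      -- In part j, t j balls are coloured true and the other a j false.
      c : Coloring n
      c i = proj₁ (chosen (part i)) i

      trues : ∀ j → count (λ i → c i ∧ inPart j i) ≡ t j
      trues j = trans (count-cong pointwise) (proj₂ (proj₂ (chosen j)))
        where
        g = proj₁ (chosen j)
        pointwise : ∀ i → c i ∧ inPart j i ≡ g i
        pointwise i with part i ≟ᶠ j
        ... | yes refl = ∧-identityʳ (c i)
        ... | no  pi≢j with g i in gi
        ...   | false = ∧-zeroʳ (c i)
        ...   | true  = contradiction (witness (part i ≟ᶠ j) (proj₁ (proj₂ (chosen j)) i gi)) pi≢j

      falses : ∀ j → count (λ i → not (c i) ∧ inPart j i) ≡ a j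
      falses j = +-cancelˡ-≡ (t j) _ _ (begin
        t j + A                             ≡⟨ cong (_+ A) (sym (trues j)) ⟩
        count (λ i → c i ∧ inPart j i) + A  ≡⟨ sym (count-split c (inPart j)) ⟩
        count (inPart j)                    ≡⟨ ∣part∣ j ⟩
        a j + t j                           ≡⟨ +-comm (a j) (t j) ⟩
        t j + a j                           ∎)
        where
        open ≡-Reasoning
        A = count (λ i → not (c i) ∧ inPart j i)

      surplus : ℕ
      surplus = Σ₃ (bit ∘ e)

      total : 2 * count c ≡ n + (3 + surplus)
      total = begin
        2 * count c                    ≡⟨ cong (2 *_) (trans (count-by-part c) (Σ₃-cong trues)) ⟩
        2 * Σ₃ t                       ≡⟨ three-part-surplus (a zero) (a (suc zero)) (a (suc (suc zero))) _ _ _ ⟩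
        Σ₃ (λ j → a j + t j) + (3 + surplus) ≡⟨ cong (_+ (3 + surplus)) (sym sizes) ⟩
        n + (3 + surplus)              ∎
        where
        open ≡-Reasoning
        sizes : n ≡ Σ₃ (λ j → a j + t j)
        sizes = trans (sym (count-true n)) (trans (count-by-part (λ _ → true)) (Σ₃-cong ∣part∣))

      c-wins : n < 2 * ∣ colorClass c true ∣
      c-wins = subst (λ x → n < 2 * x) (sym (∣colorClass-true∣ c))
                     (subst (n <_) (sym total) (m<m+n n (s≤s z≤n)))

      outvote : ∀ i → Σ (Coloring n) λ c' → Consistent F c c' × ¬ IsMajority c' i
      outvote i with c i in ci
      ... | false = c , consistent-refl F c , minority⇒¬IsMajority {c = c} {u = true} c-wins ci
      ... | true  = flipped , flip-consistent F (inPart j) (inPart-constant j) c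
                  , minority⇒¬IsMajority {c = flipped} {u = true} flipped-wins flipped-i
        where
        j = part i
        flipped : Coloring n
        flipped i' = inPart j i' xor c i'
        flipped-i : flipped i ≡ false
        flipped-i rewrite dec-true (part i ≟ᶠ part i) refl | ci = refl
        removed : count flipped + suc (bit (e j)) ≡ count c
        removed = +-cancelˡ-≡ (a j) _ _ (begin
          a j + (count flipped + suc (bit (e j)))         ≡⟨ shuffle (a j) (count flipped) (bit (e j)) ⟩
          count flipped + t j                             ≡⟨ cong (count flipped +_) (sym (trues j)) ⟩
          count flipped + count (λ i' → c i' ∧ inPart j i') ≡⟨ count-flip (inPart j) c ⟩
          count (λ i' → not (c i') ∧ inPart j i') + count c ≡⟨ cong (_+ count c) (falses j) ⟩
          a j + count c                                   ∎)
          where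
          open ≡-Reasoning
          shuffle : ∀ a x b → a + (x + suc b) ≡ x + suc (a + b)
          shuffle = solve-∀
        flipped-wins : n < 2 * ∣ colorClass flipped true ∣
        flipped-wins = subst₂ (λ m x → m < 2 * x) (sym n≡odd) (sym (∣colorClass-true∣ flipped))
                         (outvoted {h} (e j) (trans total (cong (_+ (3 + surplus)) n≡odd))
                                   (≤-Σ₃ (bit ∘ e) j) removed)

      refute : ⊥
      refute =
        let (i , certified) = common-majority {c} (λ balanced → <-irrefl (sym balanced) c-wins)
            (c' , consistent , ¬majority) = outvote i
        in ¬majority (certified c' consistent)

    three-components-refute : ∀ {h u₀ u₁ u₂} → n ≡ suc (2 * h) →
                              comp u₀ ≢ comp u₁ → comp u₀ ≢ comp u₂ → comp u₁ ≢ comp u₂ → ⊥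
    three-components-refute {h} n≡odd d₀₁ d₀₂ d₁₂ = ThreeParts.refute {h} n≡odd d₀₁ d₀₂ d₁₂

-- Upper bound

module _ {m n : ℕ} (F : Family m n) {h : ℕ} (w : Fin n → Bool) (∣w∣ : count w ≡ 2 * h) (n≤ : n ≤ suc (2 * h))
         (determined : ∀ {c c'} → Consistent F c c' → Σ Bool λ b → ∀ i → w i ≡ true → c' i ≡ b xor c i)
         where

  inside : Coloring n → Bool → ℕ
  inside c u = count (λ i → w i ∧ does (c i ≟ᵇ u))

  inside-sum : ∀ c → inside c true + inside c false ≡ h + h
  inside-sum c = trans (sym (count-+ (λ i → split (w i) (c i)))) (trans ∣w∣ (cong (h +_) (+-identityʳ h)))
    where
    split : ∀ a b → bit a ≡ bit (a ∧ does (b ≟ᵇ true)) + bit (a ∧ does (b ≟ᵇ false))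
    split false _     = refl
    split true  false = refl
    split true  true  = refl

  inside-xor : ∀ c c' b → (∀ i → w i ≡ true → c' i ≡ b xor c i) → ∀ u → inside c' u ≡ inside c (b xor u)
  inside-xor c c' b agree u = count-cong pointwise
    where
    pointwise : ∀ i → w i ∧ does (c' i ≟ᵇ u) ≡ w i ∧ does (c i ≟ᵇ (b xor u))
    pointwise i with w i in wi
    ... | false = refl
    ... | true  = trans (cong (λ x → does (x ≟ᵇ u)) (agree i wi)) (does-≟-xor b (c i) u)

  inside+outside : ∀ c u → inside c u + count (λ i → not (w i) ∧ does (c i ≟ᵇ u)) ≡ ∣ colorClass c u ∣
  inside+outside c u = sym (trans (∣colorClass∣ c u) (count-split w _))

  inside≤ : ∀ c u → inside c u ≤ ∣ colorClass c u ∣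
  inside≤ c u = ≤-trans (m≤m+n _ _) (≤-reflexive (inside+outside c u))

  inside< : ∀ c {z} → w z ≡ false → inside c (c z) < ∣ colorClass c (c z) ∣
  inside< c {z} wz = <-≤-trans (m<m+n _ (count-pos z z-outside)) (≤-reflexive (inside+outside c (c z)))
    where
    z-outside : not (w z) ∧ does (c z ≟ᵇ c z) ≡ true
    z-outside = trans (cong (λ x → not x ∧ _) wz) (dec-true (c z ≟ᵇ c z) refl)

  wins : ∀ {c : Coloring n} {u} → h < ∣ colorClass c u ∣ → n < 2 * ∣ colorClass c u ∣
  wins h<∣c∣ = <-≤-trans (s≤s n≤) (≤-trans (≤-reflexive (sym (*-suc 2 h))) (*-monoʳ-≤ 2 h<∣c∣))

  inside-preserved : ∀ c c' → Consistent F c c' → ∀ {i} → w i ≡ true → inside c' (c' i) ≡ inside c (c i)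
  inside-preserved c c' consistent {i} wi =
    let (b , agree) = determined {c} {c'} consistent
    in trans (inside-xor c c' b agree (c' i))
             (cong (inside c) (trans (cong (b xor_) (agree i wi)) (xor-involutiveˡ b (c i))))

  evenly-split-preserved : ∀ c c' → inside c true ≡ h → Consistent F c c' → ∀ u → inside c' u ≡ h
  evenly-split-preserved c c' even consistent u =
    let (b , agree) = determined {c} {c'} consistent in trans (inside-xor c c' b agree u) (evenly (b xor u))
    where
    evenly : ∀ u → inside c u ≡ h
    evenly true  = even
    evenly false = +-cancelˡ-≡ h _ _ (trans (cong (_+ inside c false) (sym even)) (inside-sum c))

  unevenly-split : ∀ c → inside c true ≢ h → ∃ λ i → w i ≡ true × h < inside c (c i)
  unevenly-split c uneven =
    let (i , member) = count-witness (λ i → w i ∧ does (c i ≟ᵇ u)) (≤-<-trans z≤n h<u)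
        (wi , ci≡u)  = split member
    in i , wi , subst (λ v → h < inside c v) (sym ci≡u) h<u
    where
    more : Σ Bool λ u → h < inside c u
    more with <-cmp (inside c true) h
    ... | tri< few _ _  = false , +-cancelˡ-< (inside c true) h _
                                    (subst (inside c true + h <_) (sym (inside-sum c)) (+-monoˡ-< h few))
    ... | tri≈ _ even _ = contradiction even uneven
    ... | tri> _ _ many = true , many
    u = proj₁ more
    h<u = proj₂ more
    split : ∀ {a i} → a ∧ does (c i ≟ᵇ u) ≡ true → a ≡ true × c i ≡ u
    split {true} {i} eq = refl , witness (c i ≟ᵇ u) eq

  uneven⇒majority : ∀ c → inside c true ≢ h → Σ (Fin n) λ i → ∀ c' → Consistent F c c' → IsMajority c' i
  uneven⇒majority c uneven = i , λ c' consistent → wins {c'} (begin-strict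
    h                        <⟨ h<inside ⟩
    inside c (c i)           ≡⟨ sym (inside-preserved c c' consistent wi) ⟩
    inside c' (c' i)         ≤⟨ inside≤ c' (c' i) ⟩
    ∣ colorClass c' (c' i) ∣ ∎)
    where
    open ≤-Reasoning
    i = proj₁ (unevenly-split c uneven)
    wi = proj₁ (proj₂ (unevenly-split c uneven))
    h<inside = proj₂ (proj₂ (unevenly-split c uneven))

  even⇒balanced : ∀ c → inside c true ≡ h → n ≡ 2 * h → ∀ c' → Consistent F c c' → NoMajority c'
  even⇒balanced c even n≡2h c' consistent = begin
    2 * ∣ colorClass c' true ∣     ≡⟨ cong (2 *_) (sym (inside+outside c' true)) ⟩
    2 * (inside c' true + outside) ≡⟨ cong (λ x → 2 * (x + outside))
                                            (evenly-split-preserved c c' even consistent true) ⟩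
    2 * (h + outside)              ≡⟨ cong (λ x → 2 * (h + x)) nothing-outside ⟩
    2 * (h + 0)                    ≡⟨ cong (2 *_) (+-identityʳ h) ⟩
    2 * h                          ≡⟨ sym n≡2h ⟩
    n                              ∎
    where
    open ≡-Reasoning
    outside = count (λ i → not (w i) ∧ does (c' i ≟ᵇ true))
    all-inside : ∀ i → w i ≡ true
    all-inside = count-full w (trans ∣w∣ (sym n≡2h))
    nothing-outside : outside ≡ 0
    nothing-outside = trans (count-cong (λ i → cong (λ x → not x ∧ _) (all-inside i))) (count-false n)

  even⇒majority : ∀ c → inside c true ≡ h → ∀ {z} → w z ≡ false → ∀ c' → Consistent F c c' → IsMajority c' z
  even⇒majority c even {z} wz c' consistent =
    wins {c'} (subst (_< ∣ colorClass c' (c' z) ∣) (evenly-split-preserved c c' even consistent (c' z))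
                     (inside< c' wz))

  determined⇒successful : Successful F
  determined⇒successful c with inside c true ≟ h
  ... | no  uneven = inj₁ (uneven⇒majority c uneven)
  ... | yes even with n ≟ 2 * h
  ...   | yes n≡2h = inj₂ (even⇒balanced c even n≡2h)
  ...   | no  n≢2h =
    let (z , wz) = count-not-full w (≤∧≢⇒< (count-≤ w) (λ ∣w∣≡n → n≢2h (trans (sym ∣w∣≡n) ∣w∣)))
    in inj₁ (z , even⇒majority c even wz)

-- The q-th window holds k = j + 2 consecutive balls from ball q(k − 1) on, moved back to fit if
-- necessary, so consecutive windows share a ball.
module Windows (j : ℕ) {n : ℕ} (k≤n : suc (suc j) ≤ n) where

  k d : ℕ
  k = suc (suc j)
  d = suc j

  start : ℕ → ℕ
  start q = (q * d) ⊓ (n ∸ k)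

  window : ℕ → Fin n → Bool
  window s i = not (below s i) ∧ below (s + k) i

  windows : ∀ m → Family m n
  windows m q = tabulate (window (start (toℕ q)))

  start+k≤n : ∀ q → start q + k ≤ n
  start+k≤n q = ≤-trans (+-monoˡ-≤ k (m⊓n≤n (q * d) (n ∸ k))) (≤-reflexive (m∸n+n≡m k≤n))

  windows-size : ∀ m → AllSize k (windows m)
  windows-size m q = trans (∣tabulate∣≡count (window s)) (+-cancelʳ-≡ s _ _ (begin
    count (window s) + s                   ≡⟨ cong (count (window s) +_) (sym ∣below-s∣) ⟩
    count (window s) + count (below {n} s) ≡⟨ sym (count-+ {g = window s} (λ i → interval (toℕ i))) ⟩
    count (below {n} (s + k))              ≡⟨ count-below n (s + k) ⟩
    (s + k) ⊓ n                            ≡⟨ m≤n⇒m⊓n≡m (start+k≤n (toℕ q)) ⟩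
    s + k                                  ≡⟨ +-comm s k ⟩
    k + s                                  ∎))
    where
    open ≡-Reasoning
    s = start (toℕ q)
    ∣below-s∣ : count (below {n} s) ≡ s
    ∣below-s∣ = trans (count-below n s) (m≤n⇒m⊓n≡m (≤-trans (m≤m+n s k) (start+k≤n (toℕ q))))
    interval : ∀ a → bit (a <ᵇ s + k) ≡ bit (not (a <ᵇ s) ∧ (a <ᵇ s + k)) + bit (a <ᵇ s)
    interval a with a <ᵇ s in a<s
    ... | false = sym (+-identityʳ _)
    ... | true rewrite <ᵇ-true (≤-trans (<ᵇ-true⁻¹ a<s) (m≤m+n s k)) = refl

  ∈-windows : ∀ {m} q {i} → start (toℕ q) ≤ toℕ i → toℕ i < start (toℕ q) + k → i ∈ windows m q
  ∈-windows q {i} s≤i i<s+k =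
    lookup⇒[]= i _ (trans (lookup∘tabulate _ i)
      (cong₂ _∧_ (cong not (<ᵇ-false s≤i)) (<ᵇ-true i<s+k)))

  -- Window x / (k − 1) contains balls x and x + 1.
  consecutive : ∀ {m x} → x < m * d → suc x < n →
                Σ (Fin m) λ q → start (toℕ q) ≤ x × suc x < start (toℕ q) + k
  consecutive {m} {x} x<md sx<n = q , start≤x , x+1<end
    where
    q : Fin m
    q = fromℕ< (m<n*o⇒m/o<n x<md)
    base = (x / d) * d
    start≤x : start (toℕ q) ≤ x
    start≤x rewrite toℕ-fromℕ< (m<n*o⇒m/o<n {x} {m} {d} x<md) = ≤-trans (m⊓n≤m base (n ∸ k)) (m/n*n≤m x d)
    x≤j+base : x ≤ j + base
    x≤j+base = ≤-trans (≤-reflexive (m≡m%n+[m/n]*n x d)) (+-monoˡ-≤ base (s≤s⁻¹ (m%n<n x d)))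
    x+1<end : suc x < start (toℕ q) + k
    x+1<end rewrite toℕ-fromℕ< (m<n*o⇒m/o<n {x} {m} {d} x<md) | +-distribʳ-⊓ k base (n ∸ k) =
      ⊓-glb (≤-trans (s≤s (s≤s x≤j+base)) (≤-reflexive (+-comm k base)))
            (≤-trans sx<n (≤-reflexive (sym (m∸n+n≡m k≤n))))

  windows-determined : ∀ {m N} → N ≤ n → N ∸ 1 ≤ m * d → ∀ {c c'} → Consistent (windows m) c c' →
                       Σ Bool λ b → ∀ i → below N i ≡ true → c' i ≡ b xor c i
  windows-determined {m} {N} N≤n cover {c} {c'} consistent =
    b , λ i i<N → along (toℕ i) (<ᵇ-true⁻¹ i<N) i refl
    where
    0<n : 0 < n
    0<n = ≤-trans (s≤s z≤n) k≤n
    first : Fin n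
    first = fromℕ< 0<n
    b : Bool
    b = c' first xor c first
    along : ∀ x → x < N → ∀ i → toℕ i ≡ x → c' i ≡ b xor c i
    along zero _ i i≡0 rewrite toℕ-injective (trans i≡0 (sym (toℕ-fromℕ< 0<n))) =
      sym (xor-involutiveʳ (c' first) (c first))
    along (suc x) x+1<N i i≡x+1 =
      sameAnswer-propagates (windows m q) {c} {c'} (consistent q) {b = b} prev∈ i∈
        (along x (<-trans (n<1+n x) x+1<N) prev toℕ-prev)
      where
      x<n : x < n
      x<n = <-trans (n<1+n x) (<-≤-trans x+1<N N≤n)
      prev : Fin n
      prev = fromℕ< x<n
      toℕ-prev : toℕ prev ≡ x
      toℕ-prev = toℕ-fromℕ< x<n
      window-q = consecutive (≤-trans (∸-monoˡ-≤ 1 x+1<N) cover) (<-≤-trans x+1<N N≤n)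
      q = proj₁ window-q
      s = start (toℕ q)
      s≤x = proj₁ (proj₂ window-q)
      x+1<e = proj₂ (proj₂ window-q)
      prev∈ : prev ∈ windows m q
      prev∈ = ∈-windows q (subst (s ≤_) (sym toℕ-prev) s≤x)
                          (subst (_< s + k) (sym toℕ-prev) (<-trans (n<1+n x) x+1<e))
      i∈ : i ∈ windows m q
      i∈ = ∈-windows q (subst (s ≤_) (sym i≡x+1) (m≤n⇒m≤1+n s≤x)) (subst (_< s + k) (sym i≡x+1) x+1<e)

ceilDiv-≤ : ∀ a j m → a ≤ m * suc j → ceilDiv a (suc j) ≤ m
ceilDiv-≤ a j m a≤ = s≤s⁻¹ (m<n*o⇒m/o<n (begin-strict
  a + j           <⟨ s≤s (+-monoˡ-≤ j a≤) ⟩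
  suc (m * suc j + j) ≡⟨ sym (+-suc (m * suc j) j) ⟩
  m * suc j + suc j   ≡⟨ +-comm (m * suc j) (suc j) ⟩
  suc m * suc j       ∎))
  where open ≤-Reasoning

≤-ceilDiv : ∀ a j → a ≤ ceilDiv a (suc j) * suc j
≤-ceilDiv a j = +-cancelʳ-≤ j a _ (begin
  a + j                                 ≡⟨ m≡m%n+[m/n]*n (a + j) (suc j) ⟩
  (a + j) % suc j + ceilDiv a (suc j) * suc j ≤⟨ +-monoˡ-≤ _ (s≤s⁻¹ (m%n<n (a + j) (suc j))) ⟩
  j + ceilDiv a (suc j) * suc j         ≡⟨ +-comm j _ ⟩
  ceilDiv a (suc j) * suc j + j         ∎)
  where open ≤-Reasoning

n≡n%2+2[n/2] : ∀ n → n ≡ n % 2 + 2 * (n / 2)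
n≡n%2+2[n/2] n = trans (m≡m%n+[m/n]*n n 2) (cong (n % 2 +_) (*-comm (n / 2) 2))

NOMvalue≡ : ∀ k n → NOMvalue k n ≡ ceilDiv (2 * (n / 2) ∸ 1) (k ∸ 1)
NOMvalue≡ k n with n % 2 | n≡n%2+2[n/2] n | m%n<n n 2
... | zero        | n≡2h   | _ = cong (λ a → ceilDiv (a ∸ 1) (k ∸ 1)) n≡2h
... | suc zero    | n≡1+2h | _ = cong (λ a → ceilDiv (a ∸ 2) (k ∸ 1)) n≡1+2h
... | suc (suc _) | _      | s≤s (s≤s ())

few-components : ∀ {m n} {F : Family m n} → Successful F → (comp : Labelling n) →
                 ConstantOnQueries F comp → count (roots comp) ≤ suc (n % 2)
few-components {n = n} success comp constant with n % 2 | n≡n%2+2[n/2] n | m%n<n n 2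
... | zero     | n≡2h   | _ = ≮⇒≥ λ 2≤roots →
  let (_ , _ , cu≢cv) = two-components comp 2≤roots
  in two-components-refute success comp constant {n / 2} n≡2h cu≢cv
... | suc zero | n≡1+2h | _ = ≮⇒≥ λ 3≤roots →
  let (_ , _ , _ , d₀₁ , d₀₂ , d₁₂) = three-components comp 3≤roots
  in three-components-refute success comp constant {n / 2} n≡1+2h d₀₁ d₀₂ d₁₂
... | suc (suc _) | _   | s≤s (s≤s ())

query-bound : ∀ {m n} k (F : Family m n) → AllSize k F → Successful F → 2 * (n / 2) ∸ 1 ≤ m * (k ∸ 1)
query-bound {m} {n} k F size success = m≤n+o⇒m∸n≤o (2 * (n / 2)) 1 (+-cancelˡ-≤ (n % 2) _ _ (begin
  n % 2 + 2 * (n / 2)        ≡⟨ sym (n≡n%2+2[n/2] n) ⟩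
  n                          ≤⟨ proj₂ (proj₂ components′) ⟩
  count (roots comp) + M     ≤⟨ +-monoˡ-≤ M (few-components success comp (proj₁ (proj₂ components′))) ⟩
  suc (n % 2) + M            ≡⟨ sym (+-suc (n % 2) M) ⟩
  n % 2 + suc M              ∎))
  where
  open ≤-Reasoning
  M = m * (k ∸ 1)
  components′ = components k F size
  comp = proj₁ components′

windows-solvable : ∀ j {n} → suc (suc j) ≤ n →
                   SolvableWith (suc (suc j)) n (ceilDiv (2 * (n / 2) ∸ 1) (suc j))
windows-solvable j {n} k≤n =
  windows m , windows-size m ,
  determined⇒successful (windows m) {h} w ∣w∣ n≤2h+1 (windows-determined 2h≤n (≤-ceilDiv (2 * h ∸ 1) j))
  where
  open Windows j k≤n
  h = n / 2
  m = ceilDiv (2 * h ∸ 1) (suc j)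
  w : Fin n → Bool
  w = below (2 * h)
  2h≤n : 2 * h ≤ n
  2h≤n = ≤-trans (m≤n+m (2 * h) (n % 2)) (≤-reflexive (sym (n≡n%2+2[n/2] n)))
  ∣w∣ : count w ≡ 2 * h
  ∣w∣ = trans (count-below n (2 * h)) (m≤n⇒m⊓n≡m 2h≤n)
  n≤2h+1 : n ≤ suc (2 * h)
  n≤2h+1 = ≤-trans (≤-reflexive (n≡n%2+2[n/2] n)) (+-monoˡ-≤ (2 * h) (s≤s⁻¹ (m%n<n n 2)))

theorem5 : (k n : ℕ) → 2 ≤ k → k ≤ n →
    SolvableWith k n (NOMvalue k n) × (∀ m → SolvableWith k n m → NOMvalue k n ≤ m)
theorem5 (suc (suc j)) n (s≤s (s≤s z≤n)) k≤n rewrite NOMvalue≡ (suc (suc j)) n =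
  windows-solvable j k≤n , λ m (F , size , success) → ceilDiv-≤ _ j m (query-bound _ F size success)
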